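{- For all configurations $C$ of the CK machine: if $C\to C'$ then $\llbracket C\rrbracket\xrightarrow{\tau}\llbracket C'\rrbracket$; and if $\llbracket C\rrbracket\xrightarrow{\tau}P$ then there exists a configuration $C'$ such that $P=\llbracket C'\rrbracket$.
   Context: HOcore. Processes $P,Q ::= a(x).P \mid \overline{a}\langle P\rangle \mid P\parallel Q \mid x \mid 0$ ($a$ channel names, $x$ process variables; $a(x)$ binds $x$; $\parallel$ associative, commutative, unit $0$). LTS: $\overline{a}\langle P\rangle \xrightarrow{\overline{a}\langle P\rangle} 0$; $a(x).Q \xrightarrow{a(P)} Q\{P/x\}$ for every $P$; if $P\xrightarrow{l}P'$ then $P\parallel Q\xrightarrow{l}P'\parallel Q$ (and symmetrically); if $P\xrightarrow{\overline{a}\langle R\rangle}P'$ and $Q\xrightarrow{a(R)}Q'$ then $P\parallel Q\xrightarrow{\tau}P'\parallel Q'$ (and symmetrically). CK machine (left-to-right call-by-value). Values $v ::= x\mid\lambda x.t$, terms $t,s ::= v\mid t\,s$, stacks $\pi ::= \mathsf{arg}(t)::\pi\mid\mathsf{fun}(v)::\pi\mid[\,]$, configurations $C ::= \langle t,\pi\rangle_{\mathsf{ev}}\mid\langle\pi,v\rangle_{\mathsf{cont}}$. Transitions: $\langle t\,s,\pi\rangle_{\mathsf{ev}}\to\langle t,\mathsf{arg}(s)::\pi\rangle_{\mathsf{ev}}$; $\langle v,\pi\rangle_{\mathsf{ev}}\to\langle\pi,v\rangle_{\mathsf{cont}}$; $\langle\mathsf{arg}(t)::\pi,v\rangle_{\mathsf{cont}}\to\langle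 t,\mathsf{fun}(v)::\pi\rangle_{\mathsf{ev}}$; $\langle\mathsf{fun}(\lambda x.t)::\pi,v\rangle_{\mathsf{cont}}\to\langle t\{v/x\},\pi\rangle_{\mathsf{ev}}$. Translation (names $c$, $val$, $b$; $\lambda$-variables identified with process variables; $p$ not free in translated entities): $\llbracket\langle t,\pi\rangle_{\mathsf{ev}}\rrbracket = \llbracket t\rrbracket\parallel\overline c\langle\llbracket\pi\rrbracket\rangle$; $\llbracket\langle\pi,v\rangle_{\mathsf{cont}}\rrbracket = \llbracket\pi\rrbracket\parallel\overline{val}\langle\llbracket v\rrbracket_v\rangle$; $\llbracket[\,]\rrbracket = \overline b\langle 0\rangle$; $\llbracket\mathsf{arg}(t)::\pi\rrbracket = \mathrm{Arg}(\llbracket t\rrbracket,\llbracket\pi\rrbracket)$; $\llbracket\mathsf{fun}(v)::\pi\rrbracket = \mathrm{Fun}(\llbracket v\rrbracket_v,\llbracket\pi\rrbracket)$, where $\mathrm{Arg}(P_t,P_\pi) = val(x).(P_t\parallel\overline c\langle\mathrm{Fun}(x,P_\pi)\rangle)$ and $\mathrm{Fun}(P_v,P_\pi) = P_v\parallel\overline c\langle P_\pi\rangle$; $\llbracket x\rrbracket_v = x$; $\llbracket\lambda x.t\rrbracket_v = val(x).\llbracket t\rrbracket$; $\llbracket v\rrbracket = c(p).(p\parallel\overline{val}\langle\llbracket v\rrbracket_v\rangle)$; $\llbracket t\,s\rrbracket = c(p).(\llbracket t\rrbracket\parallel\overline c\langle\mathrm{Arg}(\llbracket s\rrbracket,p)\rangle)$.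 -}

module Defs where

open import Data.Nat using (ℕ; zero; suc; _<ᵇ_; _≡ᵇ_; pred)
open import Data.Bool using (if_then_else_)
open import Data.Product using (Σ; _×_; _,_; ∃)

-- Conventions: binders are represented with de Bruijn indices (so
-- α-equivalence is syntactic equality); channel names are natural numbers.

Name : Set
Name = ℕ

c val b : Name
c   = 0
val = 1
b   = 2

infixr 5 _∥_

data Proc : Set where
  inp  : Name → Proc → Proc      -- a(x).P   (binds de Bruijn index 0 in P)
  out  : Name → Proc → Proc
  _∥_  : Proc → Proc → Proc
  var  : ℕ → Proc
  nil  : Proc

shiftP : ℕ → Proc → Proc
shiftP k (inp a P) = inp a (shiftP (suc k) P)
shiftP k (out a P) = out a (shiftP k P)
shiftP k (P ∥ Q)   = shiftP k P ∥ shiftP k Q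
shiftP k (var n)   = if n <ᵇ k then var n else var (suc n)
shiftP k nil       = nil

substP : ℕ → Proc → Proc → Proc
substP k R (inp a P) = inp a (substP (suc k) (shiftP 0 R) P)
substP k R (out a P) = out a (substP k R P)
substP k R (P ∥ Q)   = substP k R P ∥ substP k R Q
substP k R (var n)   =
  if n <ᵇ k then var n else (if n ≡ᵇ k then R else var (pred n))
substP k R nil       = nil

-- Q{P/x} where x is the variable bound by the enclosing input prefix
_[_] : Proc → Proc → Proc
Q [ P ] = substP 0 P Q

data Label : Set where
  outL : Name → Proc → Label
  inpL : Name → Proc → Label
  τ    : Label

data _─[_]→_ : Proc → Label → Proc → Set where
  OUT  : ∀ {a P} → out a P ─[ outL a P ]→ nil
  INP  : ∀ {a Q} P → inp a Q ─[ inpL a P ]→ (Q [ P ])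
  PARL : ∀ {P P' Q l} → P ─[ l ]→ P' → (P ∥ Q) ─[ l ]→ (P' ∥ Q)
  PARR : ∀ {P Q Q' l} → Q ─[ l ]→ Q' → (P ∥ Q) ─[ l ]→ (P ∥ Q')
  TAUL : ∀ {P P' Q Q' a R} → P ─[ outL a R ]→ P' → Q ─[ inpL a R ]→ Q' →
         (P ∥ Q) ─[ τ ]→ (P' ∥ Q')
  TAUR : ∀ {P P' Q Q' a R} → P ─[ inpL a R ]→ P' → Q ─[ outL a R ]→ Q' →
         (P ∥ Q) ─[ τ ]→ (P' ∥ Q')

infix 4 _≈_
data _≈_ : Proc → Proc → Set where
  ≈-refl  : ∀ {P} → P ≈ P
  ≈-sym   : ∀ {P Q} → P ≈ Q → Q ≈ P
  ≈-trans : ∀ {P Q R} → P ≈ Q → Q ≈ R → P ≈ R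
  ∥-assoc : ∀ {P Q R} → ((P ∥ Q) ∥ R) ≈ (P ∥ (Q ∥ R))
  ∥-comm  : ∀ {P Q} → (P ∥ Q) ≈ (Q ∥ P)
  ∥-unit  : ∀ {P} → (P ∥ nil) ≈ P
  ∥-cong  : ∀ {P P' Q Q'} → P ≈ P' → Q ≈ Q' → (P ∥ Q) ≈ (P' ∥ Q')
  inp-cong : ∀ {a P P'} → P ≈ P' → inp a P ≈ inp a P'
  out-cong : ∀ {a P P'} → P ≈ P' → out a P ≈ out a P'

data Val : Set
data Tm  : Set

data Val where
  vvar : ℕ → Val
  vlam : Tm → Val         -- λx.t  (binds index 0 in t)

data Tm where
  vtm  : Val → Tm
  app  : Tm → Tm → Tm

shiftV : ℕ → Val → Val
shiftT : ℕ → Tm → Tm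
shiftV k (vvar n) = if n <ᵇ k then vvar n else vvar (suc n)
shiftV k (vlam t) = vlam (shiftT (suc k) t)
shiftT k (vtm v)   = vtm (shiftV k v)
shiftT k (app t s) = app (shiftT k t) (shiftT k s)

substV : ℕ → Val → Val → Val
substT : ℕ → Val → Tm → Tm
substV k w (vvar n) =
  if n <ᵇ k then vvar n else (if n ≡ᵇ k then w else vvar (pred n))
substV k w (vlam t) = vlam (substT (suc k) (shiftV 0 w) t)
substT k w (vtm v)   = vtm (substV k w v)
substT k w (app t s) = app (substT k w t) (substT k w s)

-- t{v/x}, x the variable bound by the λ
_⟨_⟩ : Tm → Val → Tm
t ⟨ v ⟩ = substT 0 v t

data Stack : Set where
  arg : Tm → Stack → Stack
  fun : Val → Stack → Stack
  []  : Stack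

data Config : Set where
  ev   : Tm → Stack → Config
  cont : Stack → Val → Config

infix 4 _⟶_
data _⟶_ : Config → Config → Set where
  ck-app  : ∀ {t s π} → ev (app t s) π ⟶ ev t (arg s π)
  ck-val  : ∀ {v π} → ev (vtm v) π ⟶ cont π v
  ck-arg  : ∀ {t π v} → cont (arg t π) v ⟶ ev t (fun v π)
  ck-beta : ∀ {t π v} → cont (fun (vlam t) π) v ⟶ ev (t ⟨ v ⟩) π

-- Translation. A binder p "not free in translated entities" is realised
-- by introducing a new de Bruijn binder and shifting the translated
-- entities underneath it.

↑ : Proc → Proc
↑ = shiftP 0

Fun : Proc → Proc → Proc
Fun Pv Pπ = Pv ∥ out c Pπ

Arg : Proc → Proc → Proc
Arg Pt Pπ = inp val (↑ Pt ∥ out c (Fun (var 0) (↑ Pπ)))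

⟦_⟧v : Val → Proc
⟦_⟧t : Tm → Proc
⟦ vvar n ⟧v = var n
⟦ vlam t ⟧v = inp val ⟦ t ⟧t
⟦ vtm v ⟧t   = inp c (var 0 ∥ out val (↑ ⟦ v ⟧v))
⟦ app t s ⟧t = inp c (↑ ⟦ t ⟧t ∥ out c (Arg (↑ ⟦ s ⟧t) (var 0)))

⟦_⟧s : Stack → Proc
⟦ [] ⟧s      = out b nil
⟦ arg t π ⟧s = Arg ⟦ t ⟧t ⟦ π ⟧s
⟦ fun v π ⟧s = Fun ⟦ v ⟧v ⟦ π ⟧s

⟦_⟧ : Config → Proc
⟦ ev t π ⟧   = ⟦ t ⟧t ∥ out c ⟦ π ⟧s
⟦ cont π v ⟧ = ⟦ π ⟧s ∥ out val ⟦ v ⟧v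

{-# OPTIONS --safe #-}
module Submission where

-- Every translated configuration is an input-guarded process running next to
-- one output, and each CK transition is mirrored by exactly that communication:
-- the input's continuation, instantiated with the output's content, is
-- syntactically the translation of the successor, up to the nil left behind by
-- the consumed output. The real work is that the translation commutes with
-- de Bruijn shifting and substitution, which gives ⟦t⟧{⟦v⟧/x} = ⟦t{v/x}⟧ for the
-- β-step. Conversely a translated stack has no τ-step of its own, so every
-- τ-step of ⟦C⟧ is one of these communications.

open import Defs
open import Data.Product using (_×_; _,_; ∃)
open import Data.Nat using (ℕ; zero; suc; pred; _<ᵇ_; _≡ᵇ_; _≤_; _<_; z≤n; s≤s; _<?_)
open import Data.Nat.Properties using (≤-refl; <⇒≤; ≤-trans; <-≤-trans; m<n⇒m<1+n; m≤n⇒m≤1+n; ≮⇒≥; <-cmp)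
open import Data.Bool using (true; false)
open import Relation.Nullary using (¬_; yes; no)
open import Data.Empty using (⊥-elim)
open import Relation.Binary.Definitions using (tri<; tri≈; tri>)
open import Relation.Binary.PropositionalEquality hiding ([_])
open ≡-Reasoning

private variable
  i j k m n : ℕ
  R : Proc

<ᵇ-true : m < n → (m <ᵇ n) ≡ true
<ᵇ-true {zero}  (s≤s _)   = refl
<ᵇ-true {suc m} (s≤s m<n) = <ᵇ-true m<n

<ᵇ-false : n ≤ m → (m <ᵇ n) ≡ false
<ᵇ-false z≤n       = refl
<ᵇ-false (s≤s n≤m) = <ᵇ-false n≤m

≡ᵇ-refl : (n ≡ᵇ n) ≡ true
≡ᵇ-refl {zero}  = refl
≡ᵇ-refl {suc n} = ≡ᵇ-refl {n}

>⇒≡ᵇ-false : n < m → (m ≡ᵇ n) ≡ false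
>⇒≡ᵇ-false {zero}  (s≤s _)   = refl
>⇒≡ᵇ-false {suc n} (s≤s n<m) = >⇒≡ᵇ-false n<m

shiftP-var-< : n < k → shiftP k (var n) ≡ var n
shiftP-var-< n<k rewrite <ᵇ-true n<k = refl

shiftP-var-≥ : k ≤ n → shiftP k (var n) ≡ var (suc n)
shiftP-var-≥ k≤n rewrite <ᵇ-false k≤n = refl

substP-var-< : n < k → substP k R (var n) ≡ var n
substP-var-< n<k rewrite <ᵇ-true n<k = refl

substP-var-≡ : ∀ k R → substP k R (var k) ≡ R
substP-var-≡ k R rewrite <ᵇ-false (≤-refl {k}) | ≡ᵇ-refl {k} = refl

substP-var-> : k < n → substP k R (var n) ≡ var (pred n)
substP-var-> k<n rewrite <ᵇ-false (<⇒≤ k<n) | >⇒≡ᵇ-false k<n = refl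

shiftP-shiftP-var : i ≤ j → ∀ n → shiftP (suc j) (shiftP i (var n)) ≡ shiftP i (shiftP j (var n))
shiftP-shiftP-var {i} {j} i≤j n with n <? i | n <? j
... | yes n<i | _ = begin
  shiftP (suc j) (shiftP i (var n)) ≡⟨ cong (shiftP (suc j)) (shiftP-var-< n<i) ⟩
  shiftP (suc j) (var n)            ≡⟨ shiftP-var-< (m<n⇒m<1+n n<j) ⟩
  var n                             ≡⟨ shiftP-var-< n<i ⟨
  shiftP i (var n)                  ≡⟨ cong (shiftP i) (shiftP-var-< n<j) ⟨
  shiftP i (shiftP j (var n))       ∎
  where n<j = <-≤-trans n<i i≤j
... | no n≮i | yes n<j = begin
  shiftP (suc j) (shiftP i (var n)) ≡⟨ cong (shiftP (suc j)) (shiftP-var-≥ (≮⇒≥ n≮i)) ⟩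
  shiftP (suc j) (var (suc n))      ≡⟨ shiftP-var-< (s≤s n<j) ⟩
  var (suc n)                       ≡⟨ shiftP-var-≥ (≮⇒≥ n≮i) ⟨
  shiftP i (var n)                  ≡⟨ cong (shiftP i) (shiftP-var-< n<j) ⟨
  shiftP i (shiftP j (var n))       ∎
... | no n≮i | no n≮j = begin
  shiftP (suc j) (shiftP i (var n)) ≡⟨ cong (shiftP (suc j)) (shiftP-var-≥ (≮⇒≥ n≮i)) ⟩
  shiftP (suc j) (var (suc n))      ≡⟨ shiftP-var-≥ (s≤s (≮⇒≥ n≮j)) ⟩
  var (suc (suc n))                 ≡⟨ shiftP-var-≥ (m≤n⇒m≤1+n (≮⇒≥ n≮i)) ⟨
  shiftP i (var (suc n))            ≡⟨ cong (shiftP i) (shiftP-var-≥ (≮⇒≥ n≮j)) ⟨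
  shiftP i (shiftP j (var n))       ∎

shiftP-shiftP : i ≤ j → ∀ P → shiftP (suc j) (shiftP i P) ≡ shiftP i (shiftP j P)
shiftP-shiftP i≤j (inp a P) = cong (inp a) (shiftP-shiftP (s≤s i≤j) P)
shiftP-shiftP i≤j (out a P) = cong (out a) (shiftP-shiftP i≤j P)
shiftP-shiftP i≤j (P ∥ Q)   = cong₂ _∥_ (shiftP-shiftP i≤j P) (shiftP-shiftP i≤j Q)
shiftP-shiftP i≤j (var n)   = shiftP-shiftP-var i≤j n
shiftP-shiftP i≤j nil       = refl

shiftP-↑ : ∀ k P → shiftP (suc k) (↑ P) ≡ ↑ (shiftP k P)
shiftP-↑ k = shiftP-shiftP z≤n

substP-shiftP-var : ∀ k R n → substP k R (shiftP k (var n)) ≡ var n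
substP-shiftP-var k R n with n <? k
... | yes n<k = trans (cong (substP k R) (shiftP-var-< n<k)) (substP-var-< n<k)
... | no n≮k  = trans (cong (substP k R) (shiftP-var-≥ (≮⇒≥ n≮k))) (substP-var-> (s≤s (≮⇒≥ n≮k)))

substP-shiftP : ∀ k R P → substP k R (shiftP k P) ≡ P
substP-shiftP k R (inp a P) = cong (inp a) (substP-shiftP (suc k) (↑ R) P)
substP-shiftP k R (out a P) = cong (out a) (substP-shiftP k R P)
substP-shiftP k R (P ∥ Q)   = cong₂ _∥_ (substP-shiftP k R P) (substP-shiftP k R Q)
substP-shiftP k R (var n)   = substP-shiftP-var k R n
substP-shiftP k R nil       = refl

substP-shiftP-comm-var : j ≤ k → ∀ W n →
  substP (suc k) (shiftP j W) (shiftP j (var n)) ≡ shiftP j (substP k W (var n))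
substP-shiftP-comm-var {j} {k} j≤k W n with <-cmp n k
... | tri≈ _ refl _ = begin
  substP (suc k) (shiftP j W) (shiftP j (var k)) ≡⟨ cong (substP (suc k) _) (shiftP-var-≥ j≤k) ⟩
  substP (suc k) (shiftP j W) (var (suc k))      ≡⟨ substP-var-≡ (suc k) (shiftP j W) ⟩
  shiftP j W                                     ≡⟨ cong (shiftP j) (substP-var-≡ k W) ⟨
  shiftP j (substP k W (var k))                  ∎
... | tri> _ _ (s≤s {n = m} k≤m) = begin
  substP (suc k) (shiftP j W) (shiftP j (var (suc m)))
    ≡⟨ cong (substP (suc k) _) (shiftP-var-≥ (m≤n⇒m≤1+n (≤-trans j≤k k≤m))) ⟩
  substP (suc k) (shiftP j W) (var (suc (suc m))) ≡⟨ substP-var-> (s≤s (s≤s k≤m)) ⟩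
  var (suc m)                                     ≡⟨ shiftP-var-≥ (≤-trans j≤k k≤m) ⟨
  shiftP j (var m)                                ≡⟨ cong (shiftP j) (substP-var-> (s≤s k≤m)) ⟨
  shiftP j (substP k W (var (suc m)))             ∎
... | tri< n<k _ _ with n <? j
...   | yes n<j = begin
  substP (suc k) (shiftP j W) (shiftP j (var n)) ≡⟨ cong (substP (suc k) _) (shiftP-var-< n<j) ⟩
  substP (suc k) (shiftP j W) (var n)            ≡⟨ substP-var-< (m<n⇒m<1+n n<k) ⟩
  var n                                          ≡⟨ shiftP-var-< n<j ⟨
  shiftP j (var n)                               ≡⟨ cong (shiftP j) (substP-var-< n<k) ⟨
  shiftP j (substP k W (var n))                  ∎
...   | no n≮j = begin
  substP (suc k) (shiftP j W) (shiftP j (var n)) ≡⟨ cong (substP (suc k) _) (shiftP-var-≥ (≮⇒≥ n≮j)) ⟩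
  substP (suc k) (shiftP j W) (var (suc n))      ≡⟨ substP-var-< (s≤s n<k) ⟩
  var (suc n)                                    ≡⟨ shiftP-var-≥ (≮⇒≥ n≮j) ⟨
  shiftP j (var n)                               ≡⟨ cong (shiftP j) (substP-var-< n<k) ⟨
  shiftP j (substP k W (var n))                  ∎

substP-shiftP-comm : j ≤ k → ∀ W P →
  substP (suc k) (shiftP j W) (shiftP j P) ≡ shiftP j (substP k W P)
substP-shiftP-comm {j} {k} j≤k W (inp a P) = cong (inp a) (begin
  substP (suc (suc k)) (↑ (shiftP j W)) (shiftP (suc j) P)
    ≡⟨ cong (λ X → substP (suc (suc k)) X (shiftP (suc j) P)) (shiftP-↑ j W) ⟨
  substP (suc (suc k)) (shiftP (suc j) (↑ W)) (shiftP (suc j) P)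
    ≡⟨ substP-shiftP-comm (s≤s j≤k) (↑ W) P ⟩
  shiftP (suc j) (substP (suc k) (↑ W) P) ∎)
substP-shiftP-comm j≤k W (out a P) = cong (out a) (substP-shiftP-comm j≤k W P)
substP-shiftP-comm j≤k W (P ∥ Q)   = cong₂ _∥_ (substP-shiftP-comm j≤k W P) (substP-shiftP-comm j≤k W Q)
substP-shiftP-comm j≤k W (var n)   = substP-shiftP-comm-var j≤k W n
substP-shiftP-comm j≤k W nil       = refl

substP-↑ : ∀ k W P → substP (suc k) (↑ W) (↑ P) ≡ ↑ (substP k W P)
substP-↑ k = substP-shiftP-comm z≤n

shiftP-Arg : ∀ k P Q → shiftP k (Arg P Q) ≡ Arg (shiftP k P) (shiftP k Q)
shiftP-Arg k P Q = cong₂ (λ X Y → inp val (X ∥ out c (Fun (var 0) Y))) (shiftP-↑ k P) (shiftP-↑ k Q)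

substP-Arg : ∀ k R P Q → substP k R (Arg P Q) ≡ Arg (substP k R P) (substP k R Q)
substP-Arg k R P Q = cong₂ (λ X Y → inp val (X ∥ out c (Fun (var 0) Y))) (substP-↑ k R P) (substP-↑ k R Q)

⟦shiftV⟧ : ∀ k v → ⟦ shiftV k v ⟧v ≡ shiftP k ⟦ v ⟧v
⟦shiftT⟧ : ∀ k t → ⟦ shiftT k t ⟧t ≡ shiftP k ⟦ t ⟧t
⟦shiftV⟧ k (vvar n) with n <ᵇ k
... | true  = refl
... | false = refl
⟦shiftV⟧ k (vlam t) = cong (inp val) (⟦shiftT⟧ (suc k) t)
⟦shiftT⟧ k (vtm v) = cong (λ X → inp c (var 0 ∥ out val X))
  (trans (cong ↑ (⟦shiftV⟧ k v)) (sym (shiftP-↑ k ⟦ v ⟧v)))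
⟦shiftT⟧ k (app t s) = cong₂ (λ X Y → inp c (X ∥ out c Y))
  (lifted t) (trans (cong (λ X → Arg X (var 0)) (lifted s)) (sym (shiftP-Arg (suc k) (↑ ⟦ s ⟧t) (var 0))))
  where
  lifted : ∀ u → ↑ ⟦ shiftT k u ⟧t ≡ shiftP (suc k) (↑ ⟦ u ⟧t)
  lifted u = trans (cong ↑ (⟦shiftT⟧ k u)) (sym (shiftP-↑ k ⟦ u ⟧t))

⟦substV⟧ : ∀ k w v → ⟦ substV k w v ⟧v ≡ substP k ⟦ w ⟧v ⟦ v ⟧v
⟦substT⟧ : ∀ k w t → ⟦ substT k w t ⟧t ≡ substP k ⟦ w ⟧v ⟦ t ⟧t
⟦substV⟧ k w (vvar n) with n <ᵇ k
... | true  = refl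
... | false with n ≡ᵇ k
...   | true  = refl
...   | false = refl
⟦substV⟧ k w (vlam t) = cong (inp val)
  (trans (⟦substT⟧ (suc k) (shiftV 0 w) t) (cong (λ X → substP (suc k) X ⟦ t ⟧t) (⟦shiftV⟧ 0 w)))
⟦substT⟧ k w (vtm v) = cong (λ X → inp c (var 0 ∥ out val X))
  (trans (cong ↑ (⟦substV⟧ k w v)) (sym (substP-↑ k ⟦ w ⟧v ⟦ v ⟧v)))
⟦substT⟧ k w (app t s) = cong₂ (λ X Y → inp c (X ∥ out c Y))
  (lifted t) (trans (cong (λ X → Arg X (var 0)) (lifted s)) (sym (substP-Arg (suc k) (↑ ⟦ w ⟧v) (↑ ⟦ s ⟧t) (var 0))))
  where
  lifted : ∀ u → ↑ ⟦ substT k w u ⟧t ≡ substP (suc k) (↑ ⟦ w ⟧v) (↑ ⟦ u ⟧t)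
  lifted u = trans (cong ↑ (⟦substT⟧ k w u)) (sym (substP-↑ k ⟦ w ⟧v ⟦ u ⟧t))

↑-[] : ∀ P R → ↑ P [ R ] ≡ P
↑-[] P R = substP-shiftP 0 R P

[]-app : ∀ T S Π → (↑ T ∥ out c (Arg (↑ S) (var 0))) [ Π ] ≡ T ∥ out c (Arg S Π)
[]-app T S Π = cong₂ (λ X Y → X ∥ out c Y)
  (↑-[] T Π) (trans (substP-Arg 0 Π (↑ S) (var 0)) (cong (λ X → Arg X Π) (↑-[] S Π)))

[]-val : ∀ V Π → (var 0 ∥ out val (↑ V)) [ Π ] ≡ Π ∥ out val V
[]-val V Π = cong (λ X → Π ∥ out val X) (↑-[] V Π)

[]-arg : ∀ T Π V → (↑ T ∥ out c (Fun (var 0) (↑ Π))) [ V ] ≡ T ∥ out c (Fun V Π)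
[]-arg T Π V = cong₂ (λ X Y → X ∥ out c (Fun V Y)) (↑-[] T V) (↑-[] Π V)

[]-beta : ∀ t v → ⟦ t ⟧t [ ⟦ v ⟧v ] ≡ ⟦ t ⟨ v ⟩ ⟧t
[]-beta t v = sym (⟦substT⟧ 0 v t)

receive : ∀ {a Q Y P} → Q [ Y ] ≡ P → (inp a Q ∥ out a Y) ─[ τ ]→ (P ∥ nil)
receive refl = TAUR (INP _) OUT

receive-left : ∀ {a Q R Y P} → Q [ Y ] ≡ P → ((inp a Q ∥ R) ∥ out a Y) ─[ τ ]→ ((P ∥ R) ∥ nil)
receive-left refl = TAUR (PARL (INP _)) OUT

simulation : ∀ {C C'} → C ⟶ C' → ⟦ C ⟧ ─[ τ ]→ (⟦ C' ⟧ ∥ nil)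
simulation (ck-app {t} {s} {π})  = receive ([]-app ⟦ t ⟧t ⟦ s ⟧t ⟦ π ⟧s)
simulation (ck-val {v} {π})      = receive ([]-val ⟦ v ⟧v ⟦ π ⟧s)
simulation (ck-arg {t} {π} {v})  = receive ([]-arg ⟦ t ⟧t ⟦ π ⟧s ⟦ v ⟧v)
simulation (ck-beta {t} {π} {v}) = receive-left ([]-beta t v)

stack-τ-free : ∀ π {P} → ¬ (⟦ π ⟧s ─[ τ ]→ P)
stack-τ-free []                 ()
stack-τ-free (arg t π)          ()
stack-τ-free (fun (vvar n) π)   (PARL ())
stack-τ-free (fun (vvar n) π)   (PARR ())
stack-τ-free (fun (vvar n) π)   (TAUL () _)
stack-τ-free (fun (vvar n) π)   (TAUR () _)
stack-τ-free (fun (vlam t) π)   (PARL ())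
stack-τ-free (fun (vlam t) π)   (PARR ())
stack-τ-free (fun (vlam t) π)   (TAUL () _)
stack-τ-free (fun (vlam t) π)   (TAUR (INP _) ())

reflection : ∀ {C P} → ⟦ C ⟧ ─[ τ ]→ P → ∃ λ C' → (C ⟶ C') × (P ≡ ⟦ C' ⟧ ∥ nil)
reflection {ev (app t s) π} (TAUR (INP _) OUT) = _ , ck-app , cong (_∥ nil) ([]-app ⟦ t ⟧t ⟦ s ⟧t ⟦ π ⟧s)
reflection {ev (vtm v) π}   (TAUR (INP _) OUT) = _ , ck-val , cong (_∥ nil) ([]-val ⟦ v ⟧v ⟦ π ⟧s)
reflection {cont (arg t π) v} (TAUR (INP _) OUT) = _ , ck-arg , cong (_∥ nil) ([]-arg ⟦ t ⟧t ⟦ π ⟧s ⟦ v ⟧v)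
reflection {cont (fun (vlam t) π) v} (TAUR (PARL (INP _)) OUT) =
  _ , ck-beta , cong (λ X → (X ∥ out c ⟦ π ⟧s) ∥ nil) ([]-beta t v)
reflection {cont π v} (PARL step) = ⊥-elim (stack-τ-free π step)
reflection {cont (fun (vvar n) π) v} (TAUR (PARL ()) _)
reflection {cont (fun (vvar n) π) v} (TAUR (PARR ()) _)

theorem6p1 : (C : Config) →
    (∀ C' → C ⟶ C' → ∃ λ P → (⟦ C ⟧ ─[ τ ]→ P) × (P ≈ ⟦ C' ⟧))
    × (∀ P → ⟦ C ⟧ ─[ τ ]→ P → ∃ λ C' → P ≈ ⟦ C' ⟧)
theorem6p1 C = forward , backward
  where
  forward : ∀ C' → C ⟶ C' → ∃ λ P → (⟦ C ⟧ ─[ τ ]→ P) × (P ≈ ⟦ C' ⟧)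
  forward C' step = ⟦ C' ⟧ ∥ nil , simulation step , ∥-unit

  backward : ∀ P → ⟦ C ⟧ ─[ τ ]→ P → ∃ λ C' → P ≈ ⟦ C' ⟧
  backward P step with reflection step
  ... | C' , _ , refl = C' , ∥-unit
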